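{- Let $A\in\mathcal{S}$ be arbitrary. Then for every integer $d\geqslant 2$, $$ s_d(x;A) \succ s_{d-1}(x;A), \quad\text{i.e.}\quad \lim_{x\to+\infty}\frac{s_{d-1}(x;A)}{s_d(x;A)}=0. $$
   Context: $\mathcal{S}$ denotes the set of infinite subsets of $\mathbb{Z}_{\geqslant 0}$ (strictly increasing sequences of nonnegative integers). For $A\in\mathcal{S}$, $r(n;A)=r_1(n;A)$ is $1$ if $n\in A$ and $0$ otherwise; for $d\geqslant 2$, $r_d(n;A)=\sum_{k_1+\dots+k_d=n} r(k_1;A)\cdots r(k_d;A)$ (the number of ordered $d$-tuples of elements of $A$ summing to $n$). For real $x\geqslant 0$, $s(x;A)=s_1(x;A)=|A\cap[0,x]|$ and $s_d(x;A)=\sum_{0\leqslant n\leqslant x} r_d(n;A)$. Notation $f\succ g$ means $g=o(f)$ as $x\to+\infty$. -}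

module Defs where

open import Data.Nat using (ℕ; zero; suc; _+_; _*_; _∸_; _≤_)
open import Data.Bool using (Bool; true; false)
open import Data.Product using (∃-syntax; _×_)
open import Relation.Binary.PropositionalEquality using (_≡_)

Subset : Set
Subset = ℕ → Bool

Infinite : Subset → Set
Infinite A = ∀ m → ∃[ n ] (m ≤ n × A n ≡ true)

Σ≤ : (ℕ → ℕ) → ℕ → ℕ
Σ≤ f zero    = f zero
Σ≤ f (suc n) = Σ≤ f n + f (suc n)

r : Subset → ℕ → ℕ
r A n with A n
... | true  = 1
... | false = 0

-- r_d(n;A) = number of ordered d-tuples of elements of A summing to n.
-- r_0(n) = [n = 0] (the empty tuple), r_{d+1}(n) = Σ_{k ≤ n} r(k) r_d(n-k).
-- In particular r_1 = r.
rd : ℕ → Subset → ℕ → ℕ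
rd zero    A zero    = 1
rd zero    A (suc n) = 0
rd (suc d) A n       = Σ≤ (λ k → r A k * rd d A (n ∸ k)) n

-- s_d(x;A) = Σ_{0 ≤ n ≤ x} r_d(n;A)   (x restricted to ℕ: s_d is constant on [x, x+1))
sd : ℕ → Subset → ℕ → ℕ
sd d A x = Σ≤ (rd d A) x

-- Since s_{d+1} = r ⋆ s_d, i.e. s_{d+1}(x) = Σ_{a ≤ x} r(a) s_d(x − a), an inequality
-- k s_{j+1} ≤ s_{j+2} + C s_j survives convolution with r, so it suffices to prove it
-- for j = 0.  There, choosing M with s_1(M) ≥ k, the elements a ≤ M of A contribute
-- at least s_1(M) (s_1(x) − M) to s_2(x), whence k s_1 ≤ s_2 + M s_1(M).  Now induct on d:
-- if C s_{d−1} < s_d eventually, then (k+1) s_d ≤ s_{d+1} + C s_{d−1} < s_{d+1} + s_d,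
-- i.e. k s_d < s_{d+1}; the base case d = 1 is the unboundedness of s_1.
module Submission where

open import Defs
open import Data.Nat using (ℕ; _*_; _∸_; _≤_; _<_)
open import Data.Product using (∃-syntax)
open import Data.Nat using (zero; suc; _+_; z≤n; s≤s; s≤s⁻¹; _≤?_)
open import Data.Nat.Properties
open import Algebra.Properties.CommutativeSemigroup +-commutativeSemigroup
  using () renaming (interchange to +-interchange)
open import Algebra.Properties.CommutativeSemigroup *-commutativeSemigroup
  using () renaming (x∙yz≈y∙xz to *-swapˡ)
open import Data.Bool using (true; false)
open import Data.Product using (_,_)
open import Relation.Binary.PropositionalEquality
open import Relation.Nullary using (yes; no)
open import Data.Sum using (inj₁; inj₂)

Σ≤-mono-≤ : ∀ {f g : ℕ → ℕ} n → (∀ a → a ≤ n → f a ≤ g a) → Σ≤ f n ≤ Σ≤ g n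
Σ≤-mono-≤ zero    f≤g = f≤g 0 z≤n
Σ≤-mono-≤ (suc n) f≤g =
  +-mono-≤ (Σ≤-mono-≤ n (λ a a≤n → f≤g a (m≤n⇒m≤1+n a≤n))) (f≤g (suc n) ≤-refl)

Σ≤-cong : ∀ {f g : ℕ → ℕ} n → (∀ a → a ≤ n → f a ≡ g a) → Σ≤ f n ≡ Σ≤ g n
Σ≤-cong n f≡g = ≤-antisym (Σ≤-mono-≤ n (λ a a≤n → ≤-reflexive (f≡g a a≤n)))
                          (Σ≤-mono-≤ n (λ a a≤n → ≤-reflexive (sym (f≡g a a≤n))))

Σ≤-distrib-+ : ∀ (f g : ℕ → ℕ) n → Σ≤ (λ a → f a + g a) n ≡ Σ≤ f n + Σ≤ g n
Σ≤-distrib-+ f g zero    = refl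
Σ≤-distrib-+ f g (suc n) = begin
  Σ≤ (λ a → f a + g a) n + (f (suc n) + g (suc n))
    ≡⟨ cong (_+ (f (suc n) + g (suc n))) (Σ≤-distrib-+ f g n) ⟩
  (Σ≤ f n + Σ≤ g n) + (f (suc n) + g (suc n))
    ≡⟨ +-interchange (Σ≤ f n) (Σ≤ g n) (f (suc n)) (g (suc n)) ⟩
  (Σ≤ f n + f (suc n)) + (Σ≤ g n + g (suc n)) ∎
  where open ≡-Reasoning

*-distribˡ-Σ≤ : ∀ c (f : ℕ → ℕ) n → c * Σ≤ f n ≡ Σ≤ (λ a → c * f a) n
*-distribˡ-Σ≤ c f zero    = refl
*-distribˡ-Σ≤ c f (suc n) =
  trans (*-distribˡ-+ c (Σ≤ f n) (f (suc n))) (cong (_+ c * f (suc n)) (*-distribˡ-Σ≤ c f n))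

Σ≤-monoʳ-≤ : ∀ (f : ℕ → ℕ) {m n} → m ≤ n → Σ≤ f m ≤ Σ≤ f n
Σ≤-monoʳ-≤ f {n = zero}  z≤n = ≤-refl
Σ≤-monoʳ-≤ f {n = suc n} m≤1+n with m≤n⇒m<n∨m≡n m≤1+n
... | inj₁ m<1+n = ≤-trans (Σ≤-monoʳ-≤ f (s≤s⁻¹ m<1+n)) (m≤m+n _ _)
... | inj₂ refl  = ≤-refl

module _ {f : ℕ → ℕ} (f≤1 : ∀ a → f a ≤ 1) where

  Σ≤-indicator-≤ : ∀ n → Σ≤ f n ≤ suc n
  Σ≤-indicator-≤ zero    = f≤1 0
  Σ≤-indicator-≤ (suc n) =
    ≤-trans (+-mono-≤ (Σ≤-indicator-≤ n) (f≤1 (suc n))) (≤-reflexive (+-comm (suc n) 1))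

  Σ≤-indicator-∸ : ∀ n a → Σ≤ f n ∸ a ≤ Σ≤ f (n ∸ a)
  Σ≤-indicator-∸ n       zero    = ≤-refl
  Σ≤-indicator-∸ zero    (suc a) =
    ≤-trans (≤-reflexive (m≤n⇒m∸n≡0 (≤-trans (f≤1 0) (s≤s z≤n)))) z≤n
  Σ≤-indicator-∸ (suc n) (suc a) = begin
    (Σ≤ f n + f (suc n)) ∸ suc a ≤⟨ ∸-monoˡ-≤ (suc a) (+-monoʳ-≤ (Σ≤ f n) (f≤1 (suc n))) ⟩
    (Σ≤ f n + 1) ∸ suc a         ≡⟨ cong (_∸ suc a) (+-comm (Σ≤ f n) 1) ⟩
    Σ≤ f n ∸ a                   ≤⟨ Σ≤-indicator-∸ n a ⟩
    Σ≤ f (n ∸ a)                 ∎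
    where open ≤-Reasoning

_⋆_ : (ℕ → ℕ) → (ℕ → ℕ) → ℕ → ℕ
(w ⋆ f) x = Σ≤ (λ a → w a * f (x ∸ a)) x

⋆-dominates : ∀ w {f g h : ℕ → ℕ} k C → (∀ y → k * f y ≤ g y + C * h y) →
              ∀ x → k * (w ⋆ f) x ≤ (w ⋆ g) x + C * (w ⋆ h) x
⋆-dominates w {f} {g} {h} k C dom x = begin
  k * Σ≤ (λ a → w a * f (x ∸ a)) x
    ≡⟨ *-distribˡ-Σ≤ k _ x ⟩
  Σ≤ (λ a → k * (w a * f (x ∸ a))) x
    ≤⟨ Σ≤-mono-≤ x (λ a _ → termwise a) ⟩
  Σ≤ (λ a → w a * g (x ∸ a) + C * (w a * h (x ∸ a))) x
    ≡⟨ Σ≤-distrib-+ _ _ x ⟩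
  (w ⋆ g) x + Σ≤ (λ a → C * (w a * h (x ∸ a))) x
    ≡⟨ cong ((w ⋆ g) x +_) (sym (*-distribˡ-Σ≤ C _ x)) ⟩
  (w ⋆ g) x + C * (w ⋆ h) x ∎
  where
  open ≤-Reasoning
  termwise : ∀ a → k * (w a * f (x ∸ a)) ≤ w a * g (x ∸ a) + C * (w a * h (x ∸ a))
  termwise a = begin
    k * (w a * f (x ∸ a))                        ≡⟨ *-swapˡ k (w a) _ ⟩
    w a * (k * f (x ∸ a))                        ≤⟨ *-monoʳ-≤ (w a) (dom (x ∸ a)) ⟩
    w a * (g (x ∸ a) + C * h (x ∸ a))            ≡⟨ *-distribˡ-+ (w a) _ _ ⟩
    w a * g (x ∸ a) + w a * (C * h (x ∸ a))      ≡⟨ cong (w a * g (x ∸ a) +_) (*-swapˡ (w a) C _) ⟩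
    w a * g (x ∸ a) + C * (w a * h (x ∸ a))      ∎

module _ (A : Subset) where

  r≤1 : ∀ a → r A a ≤ 1
  r≤1 a with A a
  ... | true  = ≤-refl
  ... | false = z≤n

  sd-zero : ∀ x → sd 0 A x ≡ 1
  sd-zero zero    = refl
  sd-zero (suc x) = cong (_+ 0) (sd-zero x)

  sd-suc : ∀ d x → sd (suc d) A x ≡ (r A ⋆ sd d A) x
  sd-suc d zero    = refl
  sd-suc d (suc x) = begin
    sd (suc d) A x + rd (suc d) A (suc x)
      ≡⟨ cong (_+ rd (suc d) A (suc x)) (sd-suc d x) ⟩
    Σ≤ F x + (Σ≤ G x + r A (suc x) * rd d A (suc x ∸ suc x))
      ≡⟨ sym (+-assoc (Σ≤ F x) (Σ≤ G x) _) ⟩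
    (Σ≤ F x + Σ≤ G x) + r A (suc x) * rd d A (suc x ∸ suc x)
      ≡⟨ cong₂ _+_ (sym (Σ≤-distrib-+ F G x)) (cong (r A (suc x) *_) diagonal) ⟩
    Σ≤ (λ a → F a + G a) x + r A (suc x) * sd d A (suc x ∸ suc x)
      ≡⟨ cong (_+ r A (suc x) * sd d A (suc x ∸ suc x)) (Σ≤-cong x F+G≡) ⟩
    (r A ⋆ sd d A) (suc x) ∎
    where
    open ≡-Reasoning
    F G : ℕ → ℕ
    F a = r A a * sd d A (x ∸ a)
    G a = r A a * rd d A (suc x ∸ a)
    diagonal : rd d A (x ∸ x) ≡ sd d A (x ∸ x)
    diagonal rewrite n∸n≡0 x = refl
    F+G≡ : ∀ a → a ≤ x → F a + G a ≡ r A a * sd d A (suc x ∸ a)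
    F+G≡ a a≤x rewrite +-∸-assoc 1 a≤x =
      sym (*-distribˡ-+ (r A a) (sd d A (x ∸ a)) (rd d A (suc (x ∸ a))))

  sd-one : ∀ x → sd 1 A x ≡ Σ≤ (r A) x
  sd-one x = trans (sd-suc 0 x)
    (Σ≤-cong x (λ a _ → trans (cong (r A a *_) (sd-zero (x ∸ a))) (*-identityʳ (r A a))))

  sd-one-unbounded : Infinite A → ∀ m → ∃[ N ] (m ≤ sd 1 A N)
  sd-one-unbounded inf zero    = 0 , z≤n
  sd-one-unbounded inf (suc m) with sd-one-unbounded inf m
  ... | N , m≤s₁N with inf (suc N)
  ... | suc n , s≤s N≤n , n∈A = suc n , (begin
    suc m                ≡⟨ +-comm 1 m ⟩
    m + 1                ≤⟨ +-monoˡ-≤ 1 (≤-trans m≤s₁N (≤-reflexive (sd-one N))) ⟩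
    Σ≤ (r A) N + 1       ≤⟨ +-mono-≤ (Σ≤-monoʳ-≤ (r A) N≤n) (≤-reflexive (sym r≡1)) ⟩
    Σ≤ (r A) (suc n)     ≡⟨ sym (sd-one (suc n)) ⟩
    sd 1 A (suc n)       ∎)
    where
    open ≤-Reasoning
    r≡1 : r A (suc n) ≡ 1
    r≡1 rewrite n∈A = refl

  sd-one-≤ : ∀ x → sd 1 A x ≤ suc x
  sd-one-≤ x = ≤-trans (≤-reflexive (sd-one x)) (Σ≤-indicator-≤ r≤1 x)

  sd-one-∸ : ∀ x a → sd 1 A x ∸ a ≤ sd 1 A (x ∸ a)
  sd-one-∸ x a rewrite sd-one x | sd-one (x ∸ a) = Σ≤-indicator-∸ r≤1 x a

  sd-two-≥ : ∀ M x → sd 1 A M * (sd 1 A x ∸ M) ≤ sd 2 A x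
  sd-two-≥ M x with M ≤? x
  ... | no M≰x = ≤-trans (≤-reflexive s₁M*0≡0) z≤n
    where
    s₁M*0≡0 : sd 1 A M * (sd 1 A x ∸ M) ≡ 0
    s₁M*0≡0 rewrite m≤n⇒m∸n≡0 (≤-trans (sd-one-≤ x) (≰⇒> M≰x)) = *-zeroʳ (sd 1 A M)
  ... | yes M≤x = begin
    sd 1 A M * (sd 1 A x ∸ M)              ≡⟨ cong (_* (sd 1 A x ∸ M)) (sd-one M) ⟩
    Σ≤ (r A) M * (sd 1 A x ∸ M)            ≡⟨ *-comm (Σ≤ (r A) M) _ ⟩
    (sd 1 A x ∸ M) * Σ≤ (r A) M            ≡⟨ *-distribˡ-Σ≤ (sd 1 A x ∸ M) (r A) M ⟩
    Σ≤ (λ a → (sd 1 A x ∸ M) * r A a) M    ≤⟨ Σ≤-mono-≤ M termwise ⟩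
    Σ≤ (λ a → r A a * sd 1 A (x ∸ a)) M    ≤⟨ Σ≤-monoʳ-≤ _ M≤x ⟩
    (r A ⋆ sd 1 A) x                       ≡⟨ sym (sd-suc 1 x) ⟩
    sd 2 A x                               ∎
    where
    open ≤-Reasoning
    termwise : ∀ a → a ≤ M → (sd 1 A x ∸ M) * r A a ≤ r A a * sd 1 A (x ∸ a)
    termwise a a≤M = ≤-trans (≤-reflexive (*-comm (sd 1 A x ∸ M) (r A a)))
      (*-monoʳ-≤ (r A a) (≤-trans (∸-monoʳ-≤ (sd 1 A x) a≤M) (sd-one-∸ x a)))

  sd-one-dominated : Infinite A → ∀ k → ∃[ C ] (∀ x → k * sd 1 A x ≤ sd 2 A x + C * sd 0 A x)
  sd-one-dominated inf k with sd-one-unbounded inf k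
  ... | M , k≤s₁M = sd 1 A M * M , λ x → begin
    k * sd 1 A x                                       ≤⟨ *-monoˡ-≤ (sd 1 A x) k≤s₁M ⟩
    sd 1 A M * sd 1 A x                                ≤⟨ *-monoʳ-≤ (sd 1 A M) (m≤n+m∸n (sd 1 A x) M) ⟩
    sd 1 A M * (M + (sd 1 A x ∸ M))                    ≡⟨ *-distribˡ-+ (sd 1 A M) M _ ⟩
    sd 1 A M * M + sd 1 A M * (sd 1 A x ∸ M)           ≤⟨ +-monoʳ-≤ (sd 1 A M * M) (sd-two-≥ M x) ⟩
    sd 1 A M * M + sd 2 A x                            ≡⟨ +-comm (sd 1 A M * M) (sd 2 A x) ⟩
    sd 2 A x + sd 1 A M * M                            ≡⟨ cong (sd 2 A x +_) (sym (*-identityʳ (sd 1 A M * M))) ⟩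
    sd 2 A x + sd 1 A M * M * 1                        ≡⟨ cong (λ s → sd 2 A x + sd 1 A M * M * s) (sym (sd-zero x)) ⟩
    sd 2 A x + sd 1 A M * M * sd 0 A x                 ∎
    where open ≤-Reasoning

  sd-dominated : Infinite A → ∀ k →
                 ∃[ C ] (∀ j x → k * sd (suc j) A x ≤ sd (suc (suc j)) A x + C * sd j A x)
  sd-dominated inf k with sd-one-dominated inf k
  ... | C , base = C , induct
    where
    induct : ∀ j x → k * sd (suc j) A x ≤ sd (suc (suc j)) A x + C * sd j A x
    induct zero    x = base x
    induct (suc j) x = begin
      k * sd (2 + j) A x                                 ≡⟨ cong (k *_) (sd-suc (1 + j) x) ⟩
      k * (r A ⋆ sd (1 + j) A) x                         ≤⟨ ⋆-dominates (r A) k C (induct j) x ⟩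
      (r A ⋆ sd (2 + j) A) x + C * (r A ⋆ sd j A) x      ≡⟨ sym (cong₂ (λ s t → s + C * t) (sd-suc (2 + j) x) (sd-suc j x)) ⟩
      sd (3 + j) A x + C * sd (1 + j) A x                ∎
      where open ≤-Reasoning

  sd-eventually-dominates : Infinite A → ∀ j k → ∃[ N ] (∀ x → N ≤ x → k * sd j A x < sd (suc j) A x)
  sd-eventually-dominates inf zero k with sd-one-unbounded inf (suc k)
  ... | N , 1+k≤s₁N = N , λ x N≤x → begin-strict
    k * sd 0 A x   ≡⟨ cong (k *_) (sd-zero x) ⟩
    k * 1          ≡⟨ *-identityʳ k ⟩
    k              <⟨ 1+k≤s₁N ⟩
    sd 1 A N       ≤⟨ Σ≤-monoʳ-≤ (rd 1 A) N≤x ⟩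
    sd 1 A x       ∎
    where open ≤-Reasoning
  sd-eventually-dominates inf (suc j) k with sd-dominated inf (suc k)
  ... | C , dom with sd-eventually-dominates inf j C
  ... | N , C*sⱼ<s₁₊ⱼ = N , λ x N≤x → +-cancelˡ-< (sd (suc j) A x) _ _ (begin-strict
    sd (1 + j) A x + k * sd (1 + j) A x    ≤⟨ dom j x ⟩
    sd (2 + j) A x + C * sd j A x          <⟨ +-monoʳ-< (sd (2 + j) A x) (C*sⱼ<s₁₊ⱼ x N≤x) ⟩
    sd (2 + j) A x + sd (1 + j) A x        ≡⟨ +-comm (sd (2 + j) A x) _ ⟩
    sd (1 + j) A x + sd (2 + j) A x        ∎)
    where open ≤-Reasoning

theorem2p5 : (A : Subset) → Infinite A → (d : ℕ) → 2 ≤ d →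
    ∀ (k : ℕ) → ∃[ N ] (∀ x → N ≤ x → k * sd (d ∸ 1) A x < sd d A x)
theorem2p5 A inf (suc (suc j)) _ k = sd-eventually-dominates A inf (suc j) k
theorem2p5 A inf (suc zero) (s≤s ()) k
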